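{- Let $G$ be a beetle-free graph and let $C$ be a clean shortest even hole of $G$. Then every node $x \in N_G(C)$ lies in $N_G^{1,1}(C)\cup N_G^{1}(C)\cup N_G^{2}(C)\cup N_G^{3}(C)$.
   Context: All graphs are finite, simple, undirected. A hole is an induced simple cycle with at least four nodes; it is even if it has an even number of nodes. A shortest even hole of $G$ is an even hole of $G$ with the minimum number of nodes. For a subgraph $H$ of $G$, $N_G(H)$ is the set of nodes outside $V(H)$ adjacent to some node of $H$. For a hole $C$ and $x\in V(G)\setminus V(C)$ let $N_C(x)=N_G(x)\cap V(C)$. The node $x$ is a major node of $C$ if $N_C(x)$ contains three pairwise non-adjacent nodes; $M_G(C)$ is the set of major nodes of $C$. For $x\in N_G(C)\setminus M_G(C)$: $x\in N_G^{i}(C)$ ($1\le i\le 4$) if $|N_C(x)|=i$ and $C[N_C(x)]$ is connected; $x\in N_G^{i,j}(C)$ ($1\le i\le j\le 2$) if $C[N_C(x)]$ is disconnected and has exactly two connected components, with $i$ and $j$ nodes respectively. $C$ is clean if $M_G(C)=N_G^{2,2}(C)=\varnothing$. A diamond is a $4$-cycle $b_1b_2b_3b_4b_1$ with exactly one chord $b_2b_4$. A beetle of $G$ is an induced subgraph $B$ of $G$ whose node set is the union of the nodes of an induced diamond $b_1b_2b_3b_4b_1$ (chord $b_2b_4$) and of a tree $I$ in $G\setminus\{b_4\}$ having exactly three leaves $b_1,b_2,b_3$, such that $I\setminus\{b_1,b_2,b_3\}$ is an induced tree of $G$ with no node adjacent to $b_4$. $G$ is beetle-free if it contains no beetle. 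-}

module Defs where

open import Data.Nat using (ℕ; zero; suc; _+_; _≤_)
open import Data.Nat.Divisibility using (_∣_)
open import Data.Bool using (Bool; true; false)
open import Data.Fin using (Fin; toℕ)
open import Data.Fin.Subset using (Subset; _∈_; _∉_; ∣_∣; Nonempty; _∩_; _∪_; ⊥)
open import Data.Vec using (tabulate)
open import Data.Product using (Σ; Σ-syntax; ∃; ∃-syntax; _×_; _,_)
open import Data.Sum using (_⊎_)
open import Data.Empty renaming (⊥ to Empty)
open import Relation.Nullary using (¬_)
open import Relation.Binary.PropositionalEquality using (_≡_; _≢_)
open import Function.Bundles using (_⇔_)

record Graph : Set where
  field
    n      : ℕ
    adj    : Fin n → Fin n → Bool
    sym    : ∀ u v → adj u v ≡ adj v u
    irrefl : ∀ u → adj u u ≡ false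

open Graph public

Node : Graph → Set
Node G = Fin (n G)

Adj : (G : Graph) → Node G → Node G → Set
Adj G u v = adj G u v ≡ true

data Walk {m : ℕ} (R : Fin m → Fin m → Set) (S : Subset m) : Fin m → Fin m → Set where
  here : ∀ {u} → u ∈ S → Walk R S u u
  step : ∀ {u w v} → u ∈ S → R u w → Walk R S w v → Walk R S u v

Connected : {m : ℕ} → (Fin m → Fin m → Set) → Subset m → Set
Connected R S = ∀ u v → u ∈ S → v ∈ S → Walk R S u v

DeleteEdge : {m : ℕ} → (Fin m → Fin m → Set) → Fin m → Fin m → Fin m → Fin m → Set
DeleteEdge R u v a b = R a b × ¬ (a ≡ u × b ≡ v) × ¬ (a ≡ v × b ≡ u)

IsTree : {m : ℕ} → Subset m → (Fin m → Fin m → Set) → Set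
IsTree S R =
  Nonempty S × Connected R S ×
  (∀ u v → u ∈ S → v ∈ S → R u v → ¬ Connected (DeleteEdge R u v) S)

CycAdj : (k : ℕ) → Fin k → Fin k → Set
CycAdj k i j =
  (suc (toℕ i) ≡ toℕ j) ⊎ (suc (toℕ j) ≡ toℕ i) ⊎
  (toℕ i ≡ 0 × suc (toℕ j) ≡ k) ⊎ (toℕ j ≡ 0 × suc (toℕ i) ≡ k)

record Hole (G : Graph) : Set where
  field
    len     : ℕ
    len≥4   : 4 ≤ len
    node    : Fin len → Node G
    inj     : ∀ i j → node i ≡ node j → i ≡ j
    induced : ∀ i j → Adj G (node i) (node j) ⇔ CycAdj len i j

open Hole public

EvenHole : (G : Graph) → Hole G → Set
EvenHole G C = 2 ∣ len C

ShortestEvenHole : (G : Graph) → Hole G → Set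
ShortestEvenHole G C = EvenHole G C × (∀ (D : Hole G) → EvenHole G D → len C ≤ len D)

InHole : (G : Graph) (C : Hole G) → Node G → Set
InHole G C x = ∃[ i ] x ≡ node C i

InN : (G : Graph) (C : Hole G) → Node G → Set
InN G C x = ¬ InHole G C x × (∃[ i ] Adj G x (node C i))

-- N_C(x), as a set of positions on the hole
NC : (G : Graph) (C : Hole G) → Node G → Subset (len C)
NC G C x = tabulate (λ i → adj G x (node C i))

CAdj : (G : Graph) (C : Hole G) → Fin (len C) → Fin (len C) → Set
CAdj G C i j = Adj G (node C i) (node C j)

Major : (G : Graph) (C : Hole G) → Node G → Set
Major G C x =
  ¬ InHole G C x ×
  (Σ[ i ∈ Fin (len C) ] Σ[ j ∈ Fin (len C) ] Σ[ l ∈ Fin (len C) ]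
    (i ∈ NC G C x × j ∈ NC G C x × l ∈ NC G C x ×
     i ≢ j × i ≢ l × j ≢ l ×
     ¬ CAdj G C i j × ¬ CAdj G C i l × ¬ CAdj G C j l))

NI : (G : Graph) (C : Hole G) → ℕ → Node G → Set
NI G C i x =
  InN G C x × ¬ Major G C x ×
  ∣ NC G C x ∣ ≡ i × Connected (CAdj G C) (NC G C x)

NIJ : (G : Graph) (C : Hole G) → ℕ → ℕ → Node G → Set
NIJ G C a b x =
  InN G C x × ¬ Major G C x ×
  (Σ[ A ∈ Subset (len C) ] Σ[ B ∈ Subset (len C) ]
    (A ∪ B ≡ NC G C x × A ∩ B ≡ ⊥ ×
     Nonempty A × Nonempty B ×
     Connected (CAdj G C) A × Connected (CAdj G C) B ×
     (∀ i j → i ∈ A → j ∈ B → ¬ CAdj G C i j) ×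
     ∣ A ∣ ≡ a × ∣ B ∣ ≡ b))

Clean : (G : Graph) → Hole G → Set
Clean G C = (∀ x → ¬ Major G C x) × (∀ x → ¬ NIJ G C 2 2 x)

Diamond : (G : Graph) → Node G → Node G → Node G → Node G → Set
Diamond G b1 b2 b3 b4 =
  b1 ≢ b2 × b1 ≢ b3 × b1 ≢ b4 × b2 ≢ b3 × b2 ≢ b4 × b3 ≢ b4 ×
  Adj G b1 b2 × Adj G b2 b3 × Adj G b3 b4 × Adj G b4 b1 × Adj G b2 b4 ×
  ¬ Adj G b1 b3

-- a beetle: an induced diamond b1b2b3b4b1 (chord b2b4) together with a tree I
-- (a subgraph of G \ {b4}, node set VI, edge relation EI) having exactly the
-- three leaves b1, b2, b3, such that I \ {b1,b2,b3} (node set T) is an induced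
-- tree of G none of whose nodes is adjacent to b4.  (The beetle itself is the
-- induced subgraph of G on the union of these node sets.)
Beetle : Graph → Set
Beetle G =
  Σ[ b1 ∈ Node G ] Σ[ b2 ∈ Node G ] Σ[ b3 ∈ Node G ] Σ[ b4 ∈ Node G ]
  Σ[ VI ∈ Subset (n G) ] Σ[ EI ∈ (Node G → Node G → Bool) ] Σ[ T ∈ Subset (n G) ]
   (Diamond G b1 b2 b3 b4 ×
    (∀ u v → EI u v ≡ EI v u) ×
    (∀ u v → EI u v ≡ true → u ∈ VI × v ∈ VI × Adj G u v) ×
    b4 ∉ VI ×
    IsTree VI (λ u v → EI u v ≡ true) ×
    b1 ∈ VI × b2 ∈ VI × b3 ∈ VI ×
    ∣ tabulate (EI b1) ∣ ≡ 1 × ∣ tabulate (EI b2) ∣ ≡ 1 × ∣ tabulate (EI b3) ∣ ≡ 1 ×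
    (∀ v → v ∈ VI → ∣ tabulate (EI v) ∣ ≡ 1 → (v ≡ b1 ⊎ v ≡ b2 ⊎ v ≡ b3)) ×
    (∀ v → v ∈ T ⇔ (v ∈ VI × v ≢ b1 × v ≢ b2 × v ≢ b3)) ×
    (∀ u v → u ∈ T → v ∈ T → Adj G u v → EI u v ≡ true) ×
    IsTree T (λ u v → EI u v ≡ true) ×
    (∀ v → v ∈ T → ¬ Adj G v b4))

BeetleFree : Graph → Set
BeetleFree G = ¬ Beetle G

module Submission where

open import Defs renaming (sym to adj-comm)
open import Data.Bool using (Bool; true)
open import Data.Bool.Properties using () renaming (_≟_ to _≟ᵇ_)
open import Data.Empty using (⊥-elim) renaming (⊥ to Empty)
open import Data.Fin using (Fin; toℕ; fromℕ<) renaming (zero to fzero; suc to fsuc)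
open import Data.Fin.Properties using (toℕ-fromℕ<; toℕ-injective; toℕ<n) renaming (_≟_ to _≟ᶠ_)
open import Data.Fin.Subset using (Subset; _∈_; _∉_; ∣_∣; _∩_; _∪_; ⊥; ⁅_⁆; inside; outside)
open import Data.Fin.Subset.Properties
  using (⊆-antisym; x∈⁅x⁆; x∈⁅y⁆⇒x≡y; ∣⁅x⁆∣≡1; x∈p∪q⁻; x∈p∪q⁺; x∈p∩q⁻; ∉⊥; q⊆p∪q; p⊆q⇒∣p∣≤∣q∣;
         ∪-identityˡ; Empty-unique; ∣⊥∣≡0)
open import Data.Nat
  using (ℕ; zero; suc; pred; _+_; _*_; _∸_; _≤_; _<_; z≤n; s≤s; s≤s⁻¹; NonZero; >-nonZero; _%_; _/_; _≟_; _≤?_; _<?_)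
open import Data.Nat.Properties
open import Data.Nat.DivMod
  using (m%n<n; m%n≤n; m<n⇒m%n≡m; m≡m%n+[m/n]*n; [m+n]%n≡m%n; %-distribˡ-+; m%n%n≡m%n; n%n≡0)
open import Data.Nat.Divisibility using (_∣_; ∣m∣n⇒∣m+n; ∣m+n∣m⇒∣n; ∣-refl; _∣0)
open import Data.Nat.Tactic.RingSolver using (solve-∀)
open import Data.Product using (Σ; ∃-syntax; _×_; _,_; proj₁; proj₂)
open import Data.Sum using (_⊎_; inj₁; inj₂; [_,_]′)
import Data.Sum as Sum
open import Data.Vec using (tabulate; _∷_)
open import Data.Vec.Base using (here; there)
open import Data.Vec.Properties using (lookup∘tabulate; lookup⇒[]=; []=⇒lookup)
open import Function using (_∘_)
open import Function.Bundles using (_⇔_; mk⇔; Equivalence)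
open import Relation.Nullary using (¬_; ¬?; Dec; yes; no; does; contradiction)
open import Relation.Nullary.Decidable using (dec-true; decidable-stable; _×-dec_; _⊎-dec_)
open import Relation.Binary.Definitions using (tri<; tri≈; tri>)
open import Relation.Binary.PropositionalEquality
  using (_≡_; _≢_; refl; sym; trans; cong; cong₂; subst; subst₂; module ≡-Reasoning)

-- If x saw four
-- consecutive nodes p0 p1 p2 p3 of C, the diamond p0 x p2 p1 (chord x p1) together with the
-- tree made of the path p2 p3 … p(k-1) p0 and the spur x p3 would be a beetle
-- (FourConsecutive).  So x misses some node of C; counting from it, N_C(x) splits into
-- maximal runs of consecutive indices (module Around), and
--   * every run has at most three nodes, by the beetle again;
--   * three runs, or two runs one of which has three nodes, give three pairwise
--     non-adjacent neighbours: x would be major, which cleanness excludes;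
--   * two runs of two nodes make x an N^{2,2} node, also excluded by cleanness;
--   * runs of one and two nodes leave gaps of lengths m, m′ with m + m′ + 1 = k, closing
--     holes of lengths m + 2 and m′ + 2 through x (GapHole); as k is even, one of them is an
--     even hole shorter than C (no-complementary-holes).
-- What remains is a single run (N^1, N^2, N^3) or two single nodes (N^{1,1}).

∈-tabulate⁻ : ∀ {m} (f : Fin m → Bool) {i} → i ∈ tabulate f → f i ≡ true
∈-tabulate⁻ f {i} i∈ = trans (sym (lookup∘tabulate f i)) ([]=⇒lookup i∈)

∈-tabulate⁺ : ∀ {m} (f : Fin m → Bool) {i} → f i ≡ true → i ∈ tabulate f
∈-tabulate⁺ f {i} fi = lookup⇒[]= i (tabulate f) (trans (lookup∘tabulate f i) fi)

∣⁅i⁆∪p∣ : ∀ {m} (i : Fin m) (p : Subset m) → i ∉ p → ∣ ⁅ i ⁆ ∪ p ∣ ≡ suc ∣ p ∣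
∣⁅i⁆∪p∣ fzero (outside ∷ p) _ = cong (λ q → suc ∣ q ∣) (∪-identityˡ p)
∣⁅i⁆∪p∣ fzero (inside ∷ p) i∉p = contradiction here i∉p
∣⁅i⁆∪p∣ (fsuc i) (outside ∷ p) i∉p = ∣⁅i⁆∪p∣ i p (λ i∈p → i∉p (there i∈p))
∣⁅i⁆∪p∣ (fsuc i) (inside ∷ p) i∉p = cong suc (∣⁅i⁆∪p∣ i p (λ i∈p → i∉p (there i∈p)))

two-elements : ∀ {m} {a b : Fin m} {p : Subset m} → a ≢ b → a ∈ p → b ∈ p → 2 ≤ ∣ p ∣
two-elements {a = a} {b} {p} a≢b a∈p b∈p = begin
  2                   ≡⟨ cong suc (sym (∣⁅x⁆∣≡1 b)) ⟩
  suc ∣ ⁅ b ⁆ ∣        ≡⟨ sym (∣⁅i⁆∪p∣ a ⁅ b ⁆ (λ a∈b → a≢b (x∈⁅y⁆⇒x≡y b a∈b))) ⟩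
  ∣ ⁅ a ⁆ ∪ ⁅ b ⁆ ∣    ≤⟨ p⊆q⇒∣p∣≤∣q∣ pair⊆p ⟩
  ∣ p ∣                ∎
  where
  open ≤-Reasoning
  pair⊆p : ∀ {i} → i ∈ ⁅ a ⁆ ∪ ⁅ b ⁆ → i ∈ p
  pair⊆p {i} i∈ with x∈p∪q⁻ ⁅ a ⁆ ⁅ b ⁆ i∈
  ... | inj₁ i∈a = subst (_∈ p) (sym (x∈⁅y⁆⇒x≡y a i∈a)) a∈p
  ... | inj₂ i∈b = subst (_∈ p) (sym (x∈⁅y⁆⇒x≡y b i∈b)) b∈p

does-true⁻ : ∀ {A : Set} (a? : Dec A) → does a? ≡ true → A
does-true⁻ (yes a) _ = a
does-true⁻ (no _) ()

does-⇔ : ∀ {A B : Set} (a? : Dec A) (b? : Dec B) → (A → B) → (B → A) → does a? ≡ does b?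
does-⇔ (yes _) (yes _) _ _ = refl
does-⇔ (yes a) (no ¬b) f _ = contradiction (f a) ¬b
does-⇔ (no ¬a) (yes b) _ g = contradiction (g b) ¬a
does-⇔ (no _) (no _) _ _ = refl

module _ {m : ℕ} {R : Fin m → Fin m → Set} {S : Subset m} where

  walk-start : ∀ {u v} → Walk R S u v → u ∈ S
  walk-start (here u∈S) = u∈S
  walk-start (step u∈S _ _) = u∈S

  _++ʷ_ : ∀ {u w v} → Walk R S u w → Walk R S w v → Walk R S u v
  here _ ++ʷ w₂ = w₂
  step u∈S r w₁ ++ʷ w₂ = step u∈S r (w₁ ++ʷ w₂)

  walk-reverse : (∀ {a b} → R a b → R b a) → ∀ {u v} → Walk R S u v → Walk R S v u
  walk-reverse R-sym (here u∈S) = here u∈S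
  walk-reverse R-sym (step u∈S r w) = walk-reverse R-sym w ++ʷ step (walk-start w) (R-sym r) (here u∈S)

  connected-via-hub : (∀ {a b} → R a b → R b a) → (h : Fin m) →
                      (∀ {u} → u ∈ S → Walk R S u h) → Connected R S
  connected-via-hub R-sym h to-hub u v u∈S v∈S = to-hub u∈S ++ʷ walk-reverse R-sym (to-hub v∈S)

walk-mono : ∀ {m} {R : Fin m → Fin m → Set} {S S′ : Subset m} →
            (∀ {i} → i ∈ S → i ∈ S′) → ∀ {u v} → Walk R S u v → Walk R S′ u v
walk-mono S⊆S′ (here u∈S) = here (S⊆S′ u∈S)
walk-mono S⊆S′ (step u∈S r w) = step (S⊆S′ u∈S) r (walk-mono S⊆S′ w)

walk-invariant : ∀ {m} {R : Fin m → Fin m → Set} {S : Subset m} (Φ : Fin m → Set) →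
                 (∀ {a b} → R a b → Φ a → Φ b) → ∀ {u v} → Walk R S u v → Φ u → Φ v
walk-invariant Φ closed (here _) φ = φ
walk-invariant Φ closed (step _ r w) φ = walk-invariant Φ closed w (closed r φ)

edge-separates : ∀ {m} {R : Fin m → Fin m → Set} {S : Subset m} {u v} (Φ : Fin m → Set) →
                 (∀ {a b} → R a b → ¬ (a ≡ u × b ≡ v) → Φ a → Φ b) → Φ u → ¬ Φ v → u ∈ S → v ∈ S →
                 ¬ Connected (DeleteEdge R u v) S × ¬ Connected (DeleteEdge R v u) S
edge-separates {u = u} {v} Φ closed Φu ¬Φv u∈S v∈S =
  (λ conn → ¬Φv (walk-invariant Φ (λ (r , not-uv , _) → closed r not-uv) (conn u v u∈S v∈S) Φu)) ,
  (λ conn → ¬Φv (walk-invariant Φ (λ (r , _ , not-uv) → closed r not-uv) (conn u v u∈S v∈S) Φu))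

NoneOn : (ℕ → Set) → ℕ → ℕ → Set
NoneOn P lo hi = ∀ {j} → lo ≤ j → j < hi → ¬ P j

least-witness : ∀ {P : ℕ → Set} → (∀ j → Dec (P j)) → ∀ lo hi →
                NoneOn P lo hi ⊎ (∃[ b ] lo ≤ b × b < hi × P b × NoneOn P lo b)
least-witness P? lo zero = inj₁ (λ _ ())
least-witness P? lo (suc h) with least-witness P? lo h
... | inj₂ (b , lo≤b , b<h , Pb , none) = inj₂ (b , lo≤b , m<n⇒m<1+n b<h , Pb , none)
... | inj₁ none with lo ≤? h | P? h
...   | yes lo≤h | yes Ph = inj₂ (h , lo≤h , n<1+n h , Ph , none)
...   | yes lo≤h | no ¬Ph =
  inj₁ (λ lo≤j j<1+h → [ none lo≤j , (λ { refl → ¬Ph }) ]′ (m<1+n⇒m<n∨m≡n j<1+h))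
...   | no lo≰h | _ =
  inj₁ (λ lo≤j j<1+h → [ none lo≤j , (λ { refl → contradiction lo≤j lo≰h }) ]′ (m<1+n⇒m<n∨m≡n j<1+h))

adj-sym : ∀ (G : Graph) {u v} → Adj G u v → Adj G v u
adj-sym G {u} {v} h = trans (adj-comm G v u) h

adj-irrefl : ∀ (G : Graph) {u} → ¬ Adj G u u
adj-irrefl G {u} h with trans (sym h) (irrefl G u)
... | ()

-- `CycAdj k i j` is this relation on the values `toℕ i`, `toℕ j`.
CycAdjℕ : ℕ → ℕ → ℕ → Set
CycAdjℕ k a b = (suc a ≡ b) ⊎ (suc b ≡ a) ⊎ (a ≡ 0 × suc b ≡ k) ⊎ (b ≡ 0 × suc a ≡ k)

cycAdjℕ-sym : ∀ {k a b} → CycAdjℕ k a b → CycAdjℕ k b a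
cycAdjℕ-sym (inj₁ e) = inj₂ (inj₁ e)
cycAdjℕ-sym (inj₂ (inj₁ e)) = inj₁ e
cycAdjℕ-sym (inj₂ (inj₂ (inj₁ e))) = inj₂ (inj₂ (inj₂ e))
cycAdjℕ-sym (inj₂ (inj₂ (inj₂ e))) = inj₂ (inj₂ (inj₁ e))

module Modular (k : ℕ) .{{_ : NonZero k}} where

  suc-mod⁻ : ∀ {a b} → a < k → suc a % k ≡ b → suc a ≡ b ⊎ (b ≡ 0 × suc a ≡ k)
  suc-mod⁻ {a} a<k refl with m≤n⇒m<n∨m≡n a<k
  ... | inj₁ sa<k = inj₁ (sym (m<n⇒m%n≡m sa<k))
  ... | inj₂ refl = inj₂ (n%n≡0 (suc a) , refl)

  suc-mod⁺ : ∀ {a b} → b < k → suc a ≡ b ⊎ (b ≡ 0 × suc a ≡ k) → suc a % k ≡ b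
  suc-mod⁺ b<k (inj₁ refl) = m<n⇒m%n≡m b<k
  suc-mod⁺ _ (inj₂ (refl , refl)) = n%n≡0 k

  cycAdj⇒succ : ∀ {a b} → a < k → b < k → CycAdjℕ k a b → suc a % k ≡ b ⊎ suc b % k ≡ a
  cycAdj⇒succ a<k b<k (inj₁ e) = inj₁ (suc-mod⁺ b<k (inj₁ e))
  cycAdj⇒succ a<k b<k (inj₂ (inj₁ e)) = inj₂ (suc-mod⁺ a<k (inj₁ e))
  cycAdj⇒succ a<k b<k (inj₂ (inj₂ (inj₁ e))) = inj₂ (suc-mod⁺ a<k (inj₂ e))
  cycAdj⇒succ a<k b<k (inj₂ (inj₂ (inj₂ e))) = inj₁ (suc-mod⁺ b<k (inj₂ e))

  succ⇒cycAdj : ∀ {a b} → a < k → b < k → suc a % k ≡ b ⊎ suc b % k ≡ a → CycAdjℕ k a b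
  succ⇒cycAdj a<k b<k (inj₁ e) with suc-mod⁻ a<k e
  ... | inj₁ e′ = inj₁ e′
  ... | inj₂ e′ = inj₂ (inj₂ (inj₂ e′))
  succ⇒cycAdj a<k b<k (inj₂ e) with suc-mod⁻ b<k e
  ... | inj₁ e′ = inj₂ (inj₁ e′)
  ... | inj₂ e′ = inj₂ (inj₂ (inj₁ e′))

  mod-window-injective : ∀ {a b} → a ≤ b → b < a + k → a % k ≡ b % k → a ≡ b
  mod-window-injective {a} {b} a≤b b<a+k same-residue =
    trans a≡ (trans (cong (λ q → r + q * k) same-quotient) (sym b≡))
    where
    r = b % k
    qa = a / k
    qb = b / k
    a≡ : a ≡ r + qa * k
    a≡ = trans (m≡m%n+[m/n]*n a k) (cong (_+ qa * k) same-residue)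
    b≡ : b ≡ r + qb * k
    b≡ = m≡m%n+[m/n]*n b k
    qa≤qb : qa ≤ qb
    qa≤qb = *-cancelʳ-≤ qa qb k (+-cancelˡ-≤ r (qa * k) (qb * k) (subst₂ _≤_ a≡ b≡ a≤b))
    qb<1+qa : qb < suc qa
    qb<1+qa = *-cancelʳ-< k qb (suc qa) (+-cancelˡ-< r (qb * k) (suc qa * k)
      (subst₂ _<_ b≡ (trans (cong (_+ k) a≡) (trans (+-assoc r (qa * k) k) (cong (r +_) (+-comm (qa * k) k)))) b<a+k))
    same-quotient : qa ≡ qb
    same-quotient = ≤-antisym qa≤qb (s≤s⁻¹ qb<1+qa)

  suc-residue : ∀ a → suc (a % k) % k ≡ suc a % k
  suc-residue a = begin
    (1 + a % k) % k              ≡⟨ %-distribˡ-+ 1 (a % k) k ⟩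
    (1 % k + a % k % k) % k      ≡⟨ cong (λ z → (1 % k + z) % k) (m%n%n≡m%n a k) ⟩
    (1 % k + a % k) % k          ≡⟨ sym (%-distribˡ-+ 1 a k) ⟩
    (1 + a) % k                  ∎
    where open ≡-Reasoning

  residue-+ : ∀ s u → (s + u) % k ≡ (s % k + u) % k
  residue-+ s u = begin
    (s + u) % k                   ≡⟨ %-distribˡ-+ s u k ⟩
    (s % k + u % k) % k           ≡⟨ cong (λ z → (z + u % k) % k) (sym (m%n%n≡m%n s k)) ⟩
    (s % k % k + u % k) % k       ≡⟨ sym (%-distribˡ-+ (s % k) u k) ⟩
    (s % k + u) % k               ∎
    where open ≡-Reasoning

-- Positions on a hole C of length k: the node at index t ∈ ℕ is `c t`, indices being read
-- modulo k.  Every statement about a window of consecutive indices is made relative to an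
-- arbitrary starting index t.
module Positions (G : Graph) (C : Hole G) where
  k : ℕ
  k = len C

  3<k : 3 < k
  3<k = len≥4 C

  instance
    k-nonZero : NonZero k
    k-nonZero = >-nonZero (<-trans (s≤s z≤n) 3<k)

  open Modular k

  pos : ℕ → Fin k
  pos t = fromℕ< (m%n<n t k)

  c : ℕ → Node G
  c t = node C (pos t)

  toℕ-pos : ∀ t → toℕ (pos t) ≡ t % k
  toℕ-pos t = toℕ-fromℕ< (m%n<n t k)

  c-periodic : ∀ t → c (t + k) ≡ c t
  c-periodic t = cong (node C) (toℕ-injective (trans (toℕ-pos (t + k)) (trans ([m+n]%n≡m%n t k) (sym (toℕ-pos t)))))

  c-residue : ∀ {i j} → c i ≡ c j → i % k ≡ j % k
  c-residue {i} {j} e = trans (sym (toℕ-pos i)) (trans (cong toℕ (inj C (pos i) (pos j) e)) (toℕ-pos j))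

  succ-pos⇒ : ∀ i j → suc (toℕ (pos i)) % k ≡ toℕ (pos j) → suc i % k ≡ j % k
  succ-pos⇒ i j e =
    trans (sym (suc-residue i)) (trans (cong (λ z → suc z % k) (sym (toℕ-pos i))) (trans e (toℕ-pos j)))

  succ-pos⇐ : ∀ i j → suc i % k ≡ j % k → suc (toℕ (pos i)) % k ≡ toℕ (pos j)
  succ-pos⇐ i j e = trans (cong (λ z → suc z % k) (toℕ-pos i)) (trans (suc-residue i) (trans e (sym (toℕ-pos j))))

  adj⇒succ : ∀ {i j} → Adj G (c i) (c j) → suc i % k ≡ j % k ⊎ suc j % k ≡ i % k
  adj⇒succ {i} {j} h = Sum.map (succ-pos⇒ i j) (succ-pos⇒ j i)
    (cycAdj⇒succ (toℕ<n (pos i)) (toℕ<n (pos j)) (Equivalence.to (induced C (pos i) (pos j)) h))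

  succ⇒adj : ∀ {i j} → suc i % k ≡ j % k ⊎ suc j % k ≡ i % k → Adj G (c i) (c j)
  succ⇒adj {i} {j} s = Equivalence.from (induced C (pos i) (pos j))
    (succ⇒cycAdj (toℕ<n (pos i)) (toℕ<n (pos j)) (Sum.map (succ-pos⇐ i j) (succ-pos⇐ j i) s))

  shift-< : ∀ t {i j} → j < i + k → t + j < t + i + k
  shift-< t {i} {j} j<i+k = subst (t + j <_) (sym (+-assoc t i k)) (+-monoʳ-< t j<i+k)

  c-distinct : ∀ t {i j} → i < j → j < i + k → c (t + i) ≢ c (t + j)
  c-distinct t {i} {j} i<j j<i+k e = <⇒≢ i<j (+-cancelˡ-≡ t i j
    (mod-window-injective (+-monoʳ-≤ t (<⇒≤ i<j)) (shift-< t j<i+k) (c-residue e)))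

  c-injective : ∀ t {i j} → i < j + k → j < i + k → c (t + i) ≡ c (t + j) → i ≡ j
  c-injective t {i} {j} i<j+k j<i+k e with <-cmp i j
  ... | tri< i<j _ _ = contradiction e (c-distinct t i<j j<i+k)
  ... | tri≈ _ i≡j _ = i≡j
  ... | tri> _ _ j<i = contradiction (sym e) (c-distinct t j<i i<j+k)

  adjacent⇒consecutive : ∀ t {i j} → i < j → j < i + k → Adj G (c (t + i)) (c (t + j)) →
                         suc i ≡ j ⊎ suc j ≡ i + k
  adjacent⇒consecutive t {i} {j} i<j j<i+k h with adj⇒succ h
  ... | inj₁ e = inj₁ (+-cancelˡ-≡ t (suc i) j (trans (+-suc t i)
        (mod-window-injective (subst (_≤ t + j) (+-suc t i) (+-monoʳ-≤ t i<j))
                              (<-trans (shift-< t j<i+k) (n<1+n (t + i + k))) e)))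
  ... | inj₂ e = inj₂ (+-cancelˡ-≡ t (suc j) (i + k) (trans (+-suc t j) (trans
        (mod-window-injective (subst (_≤ t + i + k) (+-suc t j)
                                (≤-trans (+-monoʳ-≤ t j<i+k) (≤-reflexive (sym (+-assoc t i k)))))
                              (s≤s (+-monoˡ-≤ k (+-monoʳ-≤ t (<⇒≤ i<j))))
                              (trans e (sym ([m+n]%n≡m%n (t + i) k))))
        (+-assoc t i k))))

  consecutive⇒adjacent : ∀ t {i j} → suc i ≡ j ⊎ suc j ≡ i + k → Adj G (c (t + i)) (c (t + j))
  consecutive⇒adjacent t {i} (inj₁ refl) = succ⇒adj (inj₁ (cong (_% k) (sym (+-suc t i))))
  consecutive⇒adjacent t {i} {j} (inj₂ e) = succ⇒adj (inj₂ (begin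
    suc (t + j) % k     ≡⟨ cong (_% k) (trans (sym (+-suc t j)) (trans (cong (t +_) e) (sym (+-assoc t i k)))) ⟩
    (t + i + k) % k     ≡⟨ [m+n]%n≡m%n (t + i) k ⟩
    (t + i) % k         ∎))
    where open ≡-Reasoning

  adjacent⇒succ : ∀ t {i j} → i < j → suc j < i + k → Adj G (c (t + i)) (c (t + j)) → suc i ≡ j
  adjacent⇒succ t i<j sj<i+k h with adjacent⇒consecutive t i<j (<-trans (n<1+n _) sj<i+k) h
  ... | inj₁ e = e
  ... | inj₂ e = contradiction e (<⇒≢ sj<i+k)

  c-adjacent-succ : ∀ t i → Adj G (c (t + i)) (c (t + suc i))
  c-adjacent-succ t i = consecutive⇒adjacent t (inj₁ refl)

  c-nonadjacent : ∀ t {i j} → suc i < j → suc j < i + k → ¬ Adj G (c (t + i)) (c (t + j))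
  c-nonadjacent t {i} {j} si<j sj<i+k h with adjacent⇒consecutive t (<-trans (n<1+n i) si<j) (<-trans (n<1+n j) sj<i+k) h
  ... | inj₁ e = <⇒≢ si<j e
  ... | inj₂ e = <⇒≢ sj<i+k e

  pos-cover : ∀ s (i : Fin k) → ∃[ u ] u < k × pos (s + u) ≡ i
  pos-cover s i with s % k ≤? toℕ i
  ... | yes r≤i = toℕ i ∸ s % k , ≤-<-trans (m∸n≤m (toℕ i) (s % k)) (toℕ<n i) , reach (m+[n∸m]≡n r≤i)
    where
    reach : ∀ {u} → s % k + u ≡ toℕ i → pos (s + u) ≡ i
    reach {u} e = toℕ-injective (trans (toℕ-pos (s + u))
                    (trans (residue-+ s u) (trans (cong (_% k) e) (m<n⇒m%n≡m (toℕ<n i)))))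
  ... | no r≰i = u , u<k , toℕ-injective (trans (toℕ-pos (s + u)) (trans (residue-+ s u)
                   (trans (cong (_% k) r+u) (trans ([m+n]%n≡m%n (toℕ i) k) (m<n⇒m%n≡m (toℕ<n i))))))
    where
    u = toℕ i + k ∸ s % k
    r+u : s % k + u ≡ toℕ i + k
    r+u = m+[n∸m]≡n (≤-trans (m%n≤n s k) (m≤n+m k (toℕ i)))
    u<k : u < k
    u<k = +-cancelˡ-< (s % k) u k (subst (_< s % k + k) (sym r+u) (+-monoˡ-< k (≰⇒> r≰i)))

-- A node x off C that is adjacent to four consecutive nodes p0 p1 p2 p3 of C lies in a
-- beetle: the diamond p0 x p2 p1 (chord x p1) together with the tree I made of the path
-- p2 p3 … p(k-1) p0 of C and the spur x p3.  Its leaves are p0, x, p2, and I minus its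
-- leaves is the induced path p3 … p(k-1), which has no neighbour p1.  Since the nodes of
-- C are indexed by ℕ, we write p j = c (t + j) and use p k for p0.
module FourConsecutive (G : Graph) (C : Hole G) where
  open Positions G C

  module _ (x : Node G) (x∉C : ∀ t → x ≢ c t) (t : ℕ)
           (x~p0 : Adj G x (c (t + 0))) (x~p1 : Adj G x (c (t + 1)))
           (x~p2 : Adj G x (c (t + 2))) (x~p3 : Adj G x (c (t + 3))) where

    p : ℕ → Node G
    p j = c (t + j)

    x≢p : ∀ j → x ≢ p j
    x≢p j = x∉C (t + j)

    2≤⇒1≤ : ∀ {i} → 2 ≤ i → 1 ≤ i
    2≤⇒1≤ = ≤-trans (s≤s z≤n)

    2≤3 : 2 ≤ 3
    2≤3 = s≤s (s≤s z≤n)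

    2<k : 2 < k
    2<k = <-trans (n<1+n 2) 3<k

    1≤k : 1 ≤ k
    1≤k = 2≤⇒1≤ (<⇒≤ 2<k)

    p-injective : ∀ {i j} → 1 ≤ i → 1 ≤ j → i ≤ k → j ≤ k → p i ≡ p j → i ≡ j
    p-injective 1≤i 1≤j i≤k j≤k = c-injective t (≤-<-trans i≤k (m<n+m k 1≤j)) (≤-<-trans j≤k (m<n+m k 1≤i))

    adjacent-indices : ∀ {i j} → 1 ≤ i → i < j → j < k → Adj G (p i) (p j) → suc i ≡ j
    adjacent-indices 1≤i i<j j<k = adjacent⇒succ t i<j (≤-<-trans j<k (m<n+m k 1≤i))

    PathStep : Node G → Node G → ℕ → Set
    PathStep a b j = 2 ≤ j × a ≡ p j × b ≡ p (suc j)

    Step : Node G → Node G → Set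
    Step a b = (∃[ j ] j < k × PathStep a b j) ⊎ (a ≡ x × b ≡ p 3)

    Edge : Node G → Node G → Set
    Edge a b = Step a b ⊎ Step b a

    step? : ∀ a b → Dec (Step a b)
    step? a b = anyUpTo? (λ j → (2 ≤? j) ×-dec (a ≟ᶠ p j) ×-dec (b ≟ᶠ p (suc j))) k
                ⊎-dec ((a ≟ᶠ x) ×-dec (b ≟ᶠ p 3))

    edge? : ∀ a b → Dec (Edge a b)
    edge? a b = step? a b ⊎-dec step? b a

    EI : Node G → Node G → Bool
    EI a b = does (edge? a b)

    R : Node G → Node G → Set
    R a b = EI a b ≡ true

    R⇒Edge : ∀ {a b} → R a b → Edge a b
    R⇒Edge {a} {b} = does-true⁻ (edge? a b)

    Edge⇒R : ∀ {a b} → Edge a b → R a b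
    Edge⇒R {a} {b} = dec-true (edge? a b)

    edge-swap : ∀ {a b} → Edge a b → Edge b a
    edge-swap (inj₁ s) = inj₂ s
    edge-swap (inj₂ s) = inj₁ s

    R-sym : ∀ {a b} → R a b → R b a
    R-sym r = Edge⇒R (edge-swap (R⇒Edge r))

    EI-sym : ∀ a b → EI a b ≡ EI b a
    EI-sym a b = does-⇔ (edge? a b) (edge? b a) edge-swap edge-swap

    path-edge : ∀ {j} → 2 ≤ j → j < k → R (p j) (p (suc j))
    path-edge {j} 2≤j j<k = Edge⇒R (inj₁ (inj₁ (j , j<k , 2≤j , refl , refl)))

    spur-edge : R x (p 3)
    spur-edge = Edge⇒R (inj₁ (inj₂ (refl , refl)))

    InI : Node G → Set
    InI a = a ≡ x ⊎ (∃[ j ] j < suc k × 2 ≤ j × a ≡ p j)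

    InT : Node G → Set
    InT a = ∃[ j ] j < k × 3 ≤ j × a ≡ p j

    inI? : ∀ a → Dec (InI a)
    inI? a = (a ≟ᶠ x) ⊎-dec anyUpTo? (λ j → (2 ≤? j) ×-dec (a ≟ᶠ p j)) (suc k)

    inT? : ∀ a → Dec (InT a)
    inT? a = anyUpTo? (λ j → (3 ≤? j) ×-dec (a ≟ᶠ p j)) k

    VI : Subset (n G)
    VI = tabulate (λ a → does (inI? a))

    T : Subset (n G)
    T = tabulate (λ a → does (inT? a))

    ∈VI⁺ : ∀ {a} → InI a → a ∈ VI
    ∈VI⁺ {a} i = ∈-tabulate⁺ _ (dec-true (inI? a) i)

    ∈VI⁻ : ∀ {a} → a ∈ VI → InI a
    ∈VI⁻ {a} a∈ = does-true⁻ (inI? a) (∈-tabulate⁻ _ a∈)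

    ∈T⁺ : ∀ {a} → InT a → a ∈ T
    ∈T⁺ {a} i = ∈-tabulate⁺ _ (dec-true (inT? a) i)

    ∈T⁻ : ∀ {a} → a ∈ T → InT a
    ∈T⁻ {a} a∈ = does-true⁻ (inT? a) (∈-tabulate⁻ _ a∈)

    p∈VI : ∀ {j} → 2 ≤ j → j ≤ k → p j ∈ VI
    p∈VI {j} 2≤j j≤k = ∈VI⁺ (inj₂ (j , s≤s j≤k , 2≤j , refl))

    x∈VI : x ∈ VI
    x∈VI = ∈VI⁺ (inj₁ refl)

    p3∈VI : p 3 ∈ VI
    p3∈VI = p∈VI 2≤3 (<⇒≤ 3<k)

    p∈T : ∀ {j} → 3 ≤ j → j < k → p j ∈ T
    p∈T {j} 3≤j j<k = ∈T⁺ (j , j<k , 3≤j , refl)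

    step-sound : ∀ {a b} → Step a b → a ∈ VI × b ∈ VI × Adj G a b
    step-sound (inj₁ (j , j<k , 2≤j , refl , refl)) =
      p∈VI 2≤j (<⇒≤ j<k) , p∈VI (≤-trans 2≤j (n≤1+n j)) j<k , c-adjacent-succ t j
    step-sound (inj₂ (refl , refl)) = x∈VI , p3∈VI , x~p3

    EI-sound : ∀ u v → EI u v ≡ true → u ∈ VI × v ∈ VI × Adj G u v
    EI-sound u v r with R⇒Edge r
    ... | inj₁ s = step-sound s
    ... | inj₂ s with step-sound s
    ...   | v∈VI , u∈VI , h = u∈VI , v∈VI , adj-sym G h

    p1∉VI : p 1 ∉ VI
    p1∉VI p1∈VI with ∈VI⁻ p1∈VI
    ... | inj₁ e = x≢p 1 (sym e)
    ... | inj₂ (j , j<sk , 2≤j , e) = <⇒≢ 2≤j (p-injective ≤-refl (2≤⇒1≤ 2≤j) 1≤k (s≤s⁻¹ j<sk) e)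

    walk-down : ∀ (S : Subset (n G)) {lo j} → 2 ≤ lo → j ≤ k →
                (∀ {i} → lo ≤ i → i ≤ j → p i ∈ S) → lo ≤ j → Walk R S (p j) (p lo)
    walk-down S {lo} {j} 2≤lo j≤k mem lo≤j with m≤n⇒m<n∨m≡n lo≤j
    ... | inj₂ refl = here (mem lo≤j ≤-refl)
    walk-down S {j = zero} 2≤lo j≤k mem lo≤j | inj₁ ()
    walk-down S {j = suc i} 2≤lo i<k mem lo≤si | inj₁ (s≤s lo≤i) =
      step (mem lo≤si ≤-refl) (R-sym (path-edge (≤-trans 2≤lo lo≤i) i<k))
           (walk-down S 2≤lo (<⇒≤ i<k) (λ lo≤i′ i′≤i → mem lo≤i′ (≤-trans i′≤i (n≤1+n i))) lo≤i)

    VI-connected : Connected R VI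
    VI-connected = connected-via-hub R-sym (p 3) to-p3
      where
      to-p3 : ∀ {u} → u ∈ VI → Walk R VI u (p 3)
      to-p3 u∈VI with ∈VI⁻ u∈VI
      ... | inj₁ refl = step x∈VI spur-edge (here p3∈VI)
      ... | inj₂ (j , j<sk , 2≤j , refl) with 3 ≤? j
      ...   | yes 3≤j =
        walk-down VI 2≤3 (s≤s⁻¹ j<sk) (λ 3≤i i≤j → p∈VI (≤-trans 2≤3 3≤i) (≤-trans i≤j (s≤s⁻¹ j<sk))) 3≤j
      ...   | no 3≰j with ≤-antisym 2≤j (s≤s⁻¹ (≰⇒> 3≰j))
      ...     | refl = step (p∈VI ≤-refl (<⇒≤ 2<k)) (path-edge ≤-refl 2<k) (here p3∈VI)

    T-connected : Connected R T
    T-connected = connected-via-hub R-sym (p 3) to-p3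
      where
      to-p3 : ∀ {u} → u ∈ T → Walk R T u (p 3)
      to-p3 u∈T with ∈T⁻ u∈T
      ... | j , j<k , 3≤j , refl = walk-down T 2≤3 (<⇒≤ j<k) (λ 3≤i i≤j → p∈T 3≤i (≤-<-trans i≤j j<k)) 3≤j

    -- The near side of the path edge p j p(j+1) (2 ≤ j < k): the nodes p 2, …, p j and, once
    -- the spur is passed (3 ≤ j), also x.  No other edge of I leaves the near side.
    module NearSide {j} (2≤j : 2 ≤ j) (j<k : j < k) where
      Near : Node G → Set
      Near a = (a ≡ x × 3 ≤ j) ⊎ (∃[ i ] 2 ≤ i × i ≤ j × a ≡ p i)

      index : ∀ {i i′} → 2 ≤ i → i ≤ k → 2 ≤ i′ → i′ ≤ j → p i ≡ p i′ → i ≡ i′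
      index 2≤i i≤k 2≤i′ i′≤j = p-injective (2≤⇒1≤ 2≤i) (2≤⇒1≤ 2≤i′) i≤k (≤-trans i′≤j (<⇒≤ j<k))

      closed : ∀ {a b} → Edge a b → ¬ (a ≡ p j × b ≡ p (suc j)) → Near a → Near b
      closed (inj₁ (inj₁ (i , _ , _ , refl , refl))) _ (inj₁ (e , _)) = contradiction (sym e) (x≢p i)
      closed (inj₁ (inj₁ (i , i<k , 2≤i , refl , refl))) not-this-edge (inj₂ (i′ , 2≤i′ , i′≤j , e))
        with index 2≤i (<⇒≤ i<k) 2≤i′ i′≤j e
      ... | refl with m≤n⇒m<n∨m≡n i′≤j
      ...   | inj₁ i<j = inj₂ (suc i , ≤-trans 2≤i (n≤1+n i) , i<j , refl)
      ...   | inj₂ refl = contradiction (refl , refl) not-this-edge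
      closed (inj₂ (inj₁ (i , _ , _ , refl , refl))) _ (inj₁ (e , _)) = contradiction (sym e) (x≢p (suc i))
      closed (inj₂ (inj₁ (i , i<k , 2≤i , refl , refl))) _ (inj₂ (i′ , 2≤i′ , i′≤j , e))
        with index (≤-trans 2≤i (n≤1+n i)) i<k 2≤i′ i′≤j e
      ... | refl = inj₂ (i , 2≤i , <⇒≤ i′≤j , refl)
      closed (inj₁ (inj₂ (refl , refl))) _ (inj₁ (_ , 3≤j)) = inj₂ (3 , 2≤3 , 3≤j , refl)
      closed (inj₁ (inj₂ (refl , refl))) _ (inj₂ (i′ , _ , _ , e)) = contradiction e (x≢p i′)
      closed (inj₂ (inj₂ (refl , refl))) _ (inj₁ (e , _)) = contradiction (sym e) (x≢p 3)
      closed (inj₂ (inj₂ (refl , refl))) _ (inj₂ (i′ , 2≤i′ , i′≤j , e))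
        with index 2≤3 (<⇒≤ 3<k) 2≤i′ i′≤j e
      ... | refl = inj₁ (refl , i′≤j)

      near-end : Near (p j)
      near-end = inj₂ (j , 2≤j , ≤-refl , refl)

      far-end : ¬ Near (p (suc j))
      far-end (inj₁ (e , _)) = x≢p (suc j) (sym e)
      far-end (inj₂ (i , 2≤i , i≤j , e)) =
        <⇒≢ (s≤s i≤j) (sym (index (≤-trans 2≤j (n≤1+n j)) j<k 2≤i i≤j e))

    spur-closed : ∀ {a b} → Edge a b → ¬ (a ≡ x × b ≡ p 3) → a ≡ x → b ≡ x
    spur-closed (inj₁ (inj₁ (i , _ , _ , refl , _))) _ e = contradiction (sym e) (x≢p i)
    spur-closed (inj₂ (inj₁ (i , _ , _ , _ , refl))) _ e = contradiction (sym e) (x≢p (suc i))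
    spur-closed (inj₁ (inj₂ spur)) not-spur _ = contradiction spur not-spur
    spur-closed (inj₂ (inj₂ (_ , refl))) _ e = contradiction (sym e) (x≢p 3)

    bridge : ∀ (S : Subset (n G)) u v → u ∈ S → v ∈ S → R u v → ¬ Connected (DeleteEdge R u v) S
    bridge S u v u∈S v∈S r with R⇒Edge r
    ... | inj₁ (inj₁ (j , j<k , 2≤j , refl , refl)) =
      proj₁ (edge-separates Near (closed ∘ R⇒Edge) near-end far-end u∈S v∈S)
      where open NearSide 2≤j j<k
    ... | inj₂ (inj₁ (j , j<k , 2≤j , refl , refl)) =
      proj₂ (edge-separates Near (closed ∘ R⇒Edge) near-end far-end v∈S u∈S)
      where open NearSide 2≤j j<k
    ... | inj₁ (inj₂ (refl , refl)) =
      proj₁ (edge-separates (_≡ x) (spur-closed ∘ R⇒Edge) refl (x≢p 3 ∘ sym) u∈S v∈S)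
    ... | inj₂ (inj₂ (refl , refl)) =
      proj₂ (edge-separates (_≡ x) (spur-closed ∘ R⇒Edge) refl (x≢p 3 ∘ sym) v∈S u∈S)

    degree-one : ∀ {a w} → R a w → (∀ {b} → Edge a b → b ≡ w) → ∣ tabulate (EI a) ∣ ≡ 1
    degree-one {a} {w} r only = trans (cong ∣_∣ (⊆-antisym
      (λ b∈ → subst (_∈ ⁅ w ⁆) (sym (only (R⇒Edge (∈-tabulate⁻ (EI a) b∈)))) (x∈⁅x⁆ w))
      (λ b∈w → ∈-tabulate⁺ (EI a) (subst (R a) (sym (x∈⁅y⁆⇒x≡y w b∈w)) r))))
      (∣⁅x⁆∣≡1 w)

    degree-p2 : ∣ tabulate (EI (p 2)) ∣ ≡ 1
    degree-p2 = degree-one (path-edge ≤-refl 2<k) only-p3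
      where
      only-p3 : ∀ {b} → Edge (p 2) b → b ≡ p 3
      only-p3 (inj₁ (inj₁ (i , i<k , 2≤i , e , b≡)))
        with p-injective (s≤s z≤n) (2≤⇒1≤ 2≤i) (<⇒≤ 2<k) (<⇒≤ i<k) e
      ... | refl = b≡
      only-p3 (inj₂ (inj₁ (i , i<k , 2≤i , _ , e))) =
        contradiction (p-injective (s≤s z≤n) (s≤s z≤n) (<⇒≤ 2<k) i<k e) (<⇒≢ (s≤s 2≤i))
      only-p3 (inj₁ (inj₂ (e , _))) = contradiction (sym e) (x≢p 2)
      only-p3 (inj₂ (inj₂ (_ , e))) with p-injective (s≤s z≤n) (s≤s z≤n) (<⇒≤ 2<k) (<⇒≤ 3<k) e
      ... | ()

    degree-x : ∣ tabulate (EI x) ∣ ≡ 1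
    degree-x = degree-one spur-edge only-p3
      where
      only-p3 : ∀ {b} → Edge x b → b ≡ p 3
      only-p3 (inj₁ (inj₁ (i , _ , _ , e , _))) = contradiction e (x≢p i)
      only-p3 (inj₂ (inj₁ (i , _ , _ , _ , e))) = contradiction e (x≢p (suc i))
      only-p3 (inj₁ (inj₂ (_ , b≡))) = b≡
      only-p3 (inj₂ (inj₂ (_ , e))) = contradiction e (x≢p 3)

    k-1 : ℕ
    k-1 = pred k

    2≤k-1 : 2 ≤ k-1
    2≤k-1 = s≤s⁻¹ (subst (3 ≤_) (sym (suc-pred k)) (<⇒≤ 3<k))

    k-1<k : k-1 < k
    k-1<k = subst (k-1 <_) (suc-pred k) (n<1+n k-1)

    degree-pk : ∣ tabulate (EI (p k)) ∣ ≡ 1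
    degree-pk = degree-one (R-sym (subst (λ z → R (p k-1) (p z)) (suc-pred k) (path-edge 2≤k-1 k-1<k))) only-pk-1
      where
      only-pk-1 : ∀ {b} → Edge (p k) b → b ≡ p k-1
      only-pk-1 (inj₁ (inj₁ (i , i<k , 2≤i , e , _))) =
        contradiction (p-injective 1≤k (2≤⇒1≤ 2≤i) ≤-refl (<⇒≤ i<k) e) (<⇒≢ i<k ∘ sym)
      only-pk-1 (inj₂ (inj₁ (i , i<k , 2≤i , b≡ , e)))
        with p-injective 1≤k (s≤s z≤n) ≤-refl i<k e
      ... | refl = b≡
      only-pk-1 (inj₁ (inj₂ (e , _))) = contradiction (sym e) (x≢p k)
      only-pk-1 (inj₂ (inj₂ (_ , e))) =
        contradiction (p-injective 1≤k (s≤s z≤n) ≤-refl (<⇒≤ 3<k) e) (<⇒≢ 3<k ∘ sym)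

    inner-degree : ∀ {j} → 3 ≤ j → j < k → 2 ≤ ∣ tabulate (EI (p j)) ∣
    inner-degree {suc i} (s≤s 2≤i) si<k = two-elements
      (c-distinct t (<-trans (n<1+n i) (n<1+n (suc i))) (subst (_< i + k) (+-comm i 2) (+-monoʳ-< i 2<k)))
      (∈-tabulate⁺ (EI (p (suc i))) (R-sym (path-edge 2≤i (<-trans (n<1+n i) si<k))))
      (∈-tabulate⁺ (EI (p (suc i))) (path-edge (≤-trans 2≤i (n≤1+n i)) si<k))

    leaves : ∀ v → v ∈ VI → ∣ tabulate (EI v) ∣ ≡ 1 → v ≡ p k ⊎ v ≡ x ⊎ v ≡ p 2
    leaves v v∈VI deg with ∈VI⁻ v∈VI
    ... | inj₁ refl = inj₂ (inj₁ refl)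
    ... | inj₂ (j , j<sk , 2≤j , refl) with j ≟ 2 | j ≟ k
    ...   | yes refl | _ = inj₂ (inj₂ refl)
    ...   | no _ | yes refl = inj₁ refl
    ...   | no j≢2 | no j≢k =
      contradiction deg (<⇒≢ (inner-degree (≤∧≢⇒< 2≤j (j≢2 ∘ sym)) (≤∧≢⇒< (s≤s⁻¹ j<sk) j≢k)) ∘ sym)

    T-iff : ∀ v → v ∈ T ⇔ (v ∈ VI × v ≢ p k × v ≢ x × v ≢ p 2)
    T-iff v = mk⇔ to from
      where
      to : v ∈ T → v ∈ VI × v ≢ p k × v ≢ x × v ≢ p 2
      to v∈T with ∈T⁻ v∈T
      ... | j , j<k , 3≤j , refl =
        p∈VI (≤-trans 2≤3 3≤j) (<⇒≤ j<k) ,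
        c-distinct t j<k (m<n+m k (≤-trans (s≤s z≤n) 3≤j)) ,
        (λ e → x≢p j (sym e)) ,
        (c-distinct t 3≤j (<-≤-trans j<k (m≤n+m k 2)) ∘ sym)
      from : v ∈ VI × v ≢ p k × v ≢ x × v ≢ p 2 → v ∈ T
      from (v∈VI , v≢pk , v≢x , v≢p2) with ∈VI⁻ v∈VI
      ... | inj₁ e = contradiction e v≢x
      ... | inj₂ (j , j<sk , 2≤j , e) with j ≟ 2 | j ≟ k
      ...   | yes refl | _ = contradiction e v≢p2
      ...   | no _ | yes refl = contradiction e v≢pk
      ...   | no j≢2 | no j≢k = ∈T⁺ (j , ≤∧≢⇒< (s≤s⁻¹ j<sk) j≢k , ≤∧≢⇒< 2≤j (j≢2 ∘ sym) , e)

    T-induced : ∀ u v → u ∈ T → v ∈ T → Adj G u v → EI u v ≡ true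
    T-induced u v u∈T v∈T h with ∈T⁻ u∈T | ∈T⁻ v∈T
    ... | i , i<k , 3≤i , refl | j , j<k , 3≤j , refl with <-cmp i j
    ...   | tri< i<j _ _ with adjacent-indices (≤-trans (s≤s z≤n) 3≤i) i<j j<k h
    ...     | refl = path-edge (≤-trans 2≤3 3≤i) i<k
    T-induced u v u∈T v∈T h | i , i<k , 3≤i , refl | j , j<k , 3≤j , refl | tri≈ _ refl _ =
      contradiction h (adj-irrefl G)
    T-induced u v u∈T v∈T h | i , i<k , 3≤i , refl | j , j<k , 3≤j , refl | tri> _ _ j<i
      with adjacent-indices (≤-trans (s≤s z≤n) 3≤j) j<i i<k (adj-sym G h)
    ... | refl = R-sym (path-edge (≤-trans 2≤3 3≤j) j<k)

    T-avoids-p1 : ∀ v → v ∈ T → ¬ Adj G v (p 1)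
    T-avoids-p1 v v∈T h with ∈T⁻ v∈T
    ... | j , j<k , 3≤j , refl =
      <⇒≢ 3≤j (adjacent-indices ≤-refl (≤-trans (s≤s (s≤s z≤n)) 3≤j) j<k (adj-sym G h))

    diamond : Diamond G (p k) x (p 2) (p 1)
    diamond =
      (λ e → x≢p k (sym e)) ,
      (c-distinct t 2<k (m<n+m k (s≤s z≤n)) ∘ sym) ,
      (c-distinct t 1<k (m<n+m k (s≤s z≤n)) ∘ sym) ,
      (λ e → x≢p 2 e) ,
      (λ e → x≢p 1 e) ,
      (c-distinct t (n<1+n 1) (s≤s (<⇒≤ 2<k)) ∘ sym) ,
      adj-sym G x~pk , x~p2 , adj-sym G (c-adjacent-succ t 1) ,
      consecutive⇒adjacent t (inj₂ refl) , x~p1 ,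
      (λ h → c-nonadjacent t 3<k (n<1+n (suc k)) (adj-sym G h))
      where
      1<k : 1 < k
      1<k = <-trans (n<1+n 1) 2<k
      x~pk : Adj G x (p k)
      x~pk = subst (Adj G x) (trans (cong c (+-identityʳ t)) (sym (c-periodic t))) x~p0

    beetle : Beetle G
    beetle = p k , x , p 2 , p 1 , VI , EI , T ,
      diamond , EI-sym , EI-sound , p1∉VI ,
      ((x , x∈VI) , VI-connected , bridge VI) ,
      p∈VI (<⇒≤ 2<k) ≤-refl , x∈VI , p∈VI ≤-refl (<⇒≤ 2<k) ,
      degree-pk , degree-x , degree-p2 , leaves , T-iff , T-induced ,
      ((p 3 , p∈T ≤-refl 3<k) , T-connected , bridge T) ,
      T-avoids-p1

module GapHole (G : Graph) (C : Hole G) where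
  open Positions G C

  module _ (x : Node G) (x∉C : ∀ t → x ≢ c t) (t m : ℕ) (2≤m : 2 ≤ m) (m+1<k : suc m < k)
           (x~p0 : Adj G x (c (t + 0))) (x~pm : Adj G x (c (t + m)))
           (x≁interior : ∀ j → 0 < j → j < m → ¬ Adj G x (c (t + j))) where

    p : ℕ → Node G
    p j = c (t + j)

    below-k : ∀ i {j} → j ≤ m → suc j < i + k
    below-k i j≤m = ≤-<-trans (s≤s j≤m) (<-≤-trans m+1<k (m≤n+m k i))

    stretch-adj⇒ : ∀ {i j} → i ≤ m → j ≤ m → Adj G (p i) (p j) → suc i ≡ j ⊎ suc j ≡ i
    stretch-adj⇒ {i} {j} i≤m j≤m h with <-cmp i j
    ... | tri< i<j _ _ = inj₁ (adjacent⇒succ t i<j (below-k i j≤m) h)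
    ... | tri≈ _ refl _ = contradiction h (adj-irrefl G)
    ... | tri> _ _ j<i = inj₂ (adjacent⇒succ t j<i (below-k j i≤m) (adj-sym G h))

    stretch-adj⇐ : ∀ {i j} → suc i ≡ j ⊎ suc j ≡ i → Adj G (p i) (p j)
    stretch-adj⇐ (inj₁ e) = consecutive⇒adjacent t (inj₁ e)
    stretch-adj⇐ (inj₂ e) = adj-sym G (consecutive⇒adjacent t (inj₁ e))

    x-adj⇒ : ∀ {j} → j ≤ m → Adj G x (p j) → j ≡ 0 ⊎ j ≡ m
    x-adj⇒ {zero} _ _ = inj₁ refl
    x-adj⇒ {suc j} sj≤m h with m≤n⇒m<n∨m≡n sj≤m
    ... | inj₁ sj<m = contradiction h (x≁interior (suc j) (s≤s z≤n) sj<m)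
    ... | inj₂ e = inj₂ e

    x-adj⇐ : ∀ {j} → j ≡ 0 ⊎ j ≡ m → Adj G x (p j)
    x-adj⇐ (inj₁ refl) = x~p0
    x-adj⇐ (inj₂ refl) = x~pm

    L : ℕ
    L = suc (suc m)

    hole-node : Fin L → Node G
    hole-node fzero = x
    hole-node (fsuc j) = p (toℕ j)

    index≤m : (j : Fin (suc m)) → toℕ j ≤ m
    index≤m j = s≤s⁻¹ (toℕ<n j)

    hole-injective : ∀ i j → hole-node i ≡ hole-node j → i ≡ j
    hole-injective fzero fzero _ = refl
    hole-injective fzero (fsuc j) e = contradiction e (x∉C (t + toℕ j))
    hole-injective (fsuc i) fzero e = contradiction (sym e) (x∉C (t + toℕ i))
    hole-injective (fsuc i) (fsuc j) e = cong fsuc (toℕ-injective (c-injective t (in-window i) (in-window j) e))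
      where
      in-window : ∀ (i : Fin (suc m)) {j} → toℕ i < j + k
      in-window i = <-≤-trans (<-trans (s≤s (index≤m i)) m+1<k) (m≤n+m k _)

    x-cycAdj⇔ : ∀ j → (j ≡ 0 ⊎ j ≡ m) ⇔ CycAdjℕ L 0 (suc j)
    x-cycAdj⇔ j = mk⇔ to from
      where
      to : j ≡ 0 ⊎ j ≡ m → CycAdjℕ L 0 (suc j)
      to (inj₁ refl) = inj₁ refl
      to (inj₂ refl) = inj₂ (inj₂ (inj₁ (refl , refl)))
      from : CycAdjℕ L 0 (suc j) → j ≡ 0 ⊎ j ≡ m
      from (inj₁ e) = inj₁ (sym (suc-injective e))
      from (inj₂ (inj₁ ()))
      from (inj₂ (inj₂ (inj₁ (_ , e)))) = inj₂ (suc-injective (suc-injective e))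
      from (inj₂ (inj₂ (inj₂ (() , _))))

    stretch-cycAdj⇔ : ∀ i j → (suc i ≡ j ⊎ suc j ≡ i) ⇔ CycAdjℕ L (suc i) (suc j)
    stretch-cycAdj⇔ i j = mk⇔ to from
      where
      to : suc i ≡ j ⊎ suc j ≡ i → CycAdjℕ L (suc i) (suc j)
      to (inj₁ e) = inj₁ (cong suc e)
      to (inj₂ e) = inj₂ (inj₁ (cong suc e))
      from : CycAdjℕ L (suc i) (suc j) → suc i ≡ j ⊎ suc j ≡ i
      from (inj₁ e) = inj₁ (suc-injective e)
      from (inj₂ (inj₁ e)) = inj₂ (suc-injective e)
      from (inj₂ (inj₂ (inj₁ (() , _))))
      from (inj₂ (inj₂ (inj₂ (() , _))))

    hole-induced : ∀ i j → Adj G (hole-node i) (hole-node j) ⇔ CycAdj L i j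
    hole-induced fzero fzero = mk⇔ (λ h → contradiction h (adj-irrefl G)) absurd
      where
      absurd : CycAdjℕ L 0 0 → Adj G x x
      absurd (inj₂ (inj₂ (inj₁ (_ , ()))))
      absurd (inj₂ (inj₂ (inj₂ (_ , ()))))
    hole-induced fzero (fsuc j) =
      mk⇔ (Equivalence.to (x-cycAdj⇔ _) ∘ x-adj⇒ (index≤m j)) (x-adj⇐ ∘ Equivalence.from (x-cycAdj⇔ _))
    hole-induced (fsuc i) fzero =
      mk⇔ (cycAdjℕ-sym ∘ Equivalence.to (x-cycAdj⇔ _) ∘ x-adj⇒ (index≤m i) ∘ adj-sym G)
          (adj-sym G ∘ x-adj⇐ ∘ Equivalence.from (x-cycAdj⇔ _) ∘ cycAdjℕ-sym)
    hole-induced (fsuc i) (fsuc j) =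
      mk⇔ (Equivalence.to (stretch-cycAdj⇔ _ _) ∘ stretch-adj⇒ (index≤m i) (index≤m j))
          (stretch-adj⇐ ∘ Equivalence.from (stretch-cycAdj⇔ _ _))

    gap-hole : Hole G
    gap-hole = record
      { len = L ; len≥4 = s≤s (s≤s 2≤m) ; node = hole-node ; inj = hole-injective ; induced = hole-induced }

even-or-odd : ∀ m → (2 ∣ m) ⊎ (2 ∣ suc m)
even-or-odd zero = inj₁ (2 ∣0)
even-or-odd (suc m) with even-or-odd m
... | inj₁ 2∣m = inj₂ (∣m∣n⇒∣m+n ∣-refl 2∣m)
... | inj₂ 2∣sm = inj₁ 2∣sm

not-shorter : ∀ (G : Graph) (C : Hole G) → ShortestEvenHole G C → (D : Hole G) → 2 ∣ len D → ¬ len D < len C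
not-shorter G C (_ , C-shortest) D D-even shorter = <⇒≱ shorter (C-shortest D D-even)

-- A shortest even hole C admits no pair of holes of lengths m + 2 and m′ + 2 with
-- m + 1 + m′ = len C (m, m′ ≥ 2): since len C is even, one of m, m′ is even, and that
-- hole would be an even hole shorter than C.
no-complementary-holes : ∀ (G : Graph) (C : Hole G) → ShortestEvenHole G C →
                         ∀ {m m′} → 2 ≤ m → 2 ≤ m′ → suc m + m′ ≡ len C → (H H′ : Hole G) →
                         len H ≡ suc (suc m) → len H′ ≡ suc (suc m′) → Empty
no-complementary-holes G C seh@(C-even , _) {m} {m′} 2≤m 2≤m′ split H H′ lenH lenH′ with even-or-odd m
... | inj₁ 2∣m = not-shorter G C seh H (subst (2 ∣_) (sym lenH) (∣m∣n⇒∣m+n ∣-refl 2∣m))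
      (subst₂ _<_ (sym lenH) split (s≤s (subst (suc (suc m) ≤_) (+-comm m′ m) (+-monoˡ-≤ m 2≤m′))))
... | inj₂ 2∣m+1 = not-shorter G C seh H′ (subst (2 ∣_) (sym lenH′) (∣m∣n⇒∣m+n ∣-refl 2∣m′))
      (subst₂ _<_ (sym lenH′) split (s≤s (+-monoˡ-≤ m′ 2≤m)))
  where
  2∣m′ : 2 ∣ m′
  2∣m′ = ∣m+n∣m⇒∣n (subst (2 ∣_) (sym split) C-even) 2∣m+1

off-hole : ∀ (G : Graph) (C : Hole G) {x} → InN G C x → ∀ t → x ≢ Positions.c G C t
off-hole G C x∈N t e = proj₁ x∈N (Positions.pos G C t , e)

module Attachment (G : Graph) (C : Hole G) (x : Node G) (x∈N : InN G C x) where
  open Positions G C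

  seen-below-k : ∀ s → ∃[ u ] u < k × Adj G x (c (s + u))
  seen-below-k s with proj₂ x∈N
  ... | i , x~i with pos-cover s i
  ...   | u , u<k , refl = u , u<k , x~i

  sees : ∀ j → Dec (Adj G x (c j))
  sees j = adj G x (c j) ≟ᵇ _

  drop-0 : ∀ {j} → ¬ Adj G x (c j) → ¬ Adj G x (c (j + 0))
  drop-0 {j} x≁j = x≁j ∘ subst (Adj G x ∘ c) (+-identityʳ j)

  -- In a beetle-free graph, x also misses some node of C: otherwise it would see four
  -- consecutive nodes.
  unseen-index : BeetleFree G → ∃[ s ] ¬ Adj G x (c (s + 0))
  unseen-index beetle-free with seen-below-k 0
  ... | t , _ , x~t with sees (t + 1) | sees (t + 2) | sees (t + 3)
  ...   | no x≁1 | _ | _ = t + 1 , drop-0 x≁1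
  ...   | yes _ | no x≁2 | _ = t + 2 , drop-0 x≁2
  ...   | yes _ | yes _ | no x≁3 = t + 3 , drop-0 x≁3
  ...   | yes x~1 | yes x~2 | yes x~3 =
    ⊥-elim (beetle-free (FourConsecutive.beetle G C x (off-hole G C x∈N) t
      (subst (Adj G x ∘ c) (sym (+-identityʳ t)) x~t) x~1 x~2 x~3))

regroup : ∀ u w m₁ m₂ → u + w + (suc m₁ + m₂) ≡ suc ((u + m₁) + (w + m₂))
regroup = solve-∀

Outcome : (G : Graph) → Hole G → Node G → Set
Outcome G C x = NIJ G C 1 1 x ⊎ NI G C 1 x ⊎ NI G C 2 x ⊎ NI G C 3 x

module Around (G : Graph) (C : Hole G) (x : Node G) (x∈N : InN G C x) (x-minor : ¬ Major G C x)
              (s : ℕ) (x≁s : ¬ Adj G x (Positions.c G C (s + 0))) where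
  open Positions G C

  x∉C : ∀ t → x ≢ c t
  x∉C = off-hole G C x∈N

  Q : ℕ → Set
  Q u = Adj G x (c (s + u))

  Q? : ∀ u → Dec (Q u)
  Q? u = adj G x (c (s + u)) ≟ᵇ _

  P : ℕ → Fin k
  P u = pos (s + u)

  period : ∀ u → c (s + (u + k)) ≡ c (s + u)
  period u = trans (cong c (sym (+-assoc s u k))) (c-periodic (s + u))

  Q-periodic : ∀ {u} → Q u → Q (u + k)
  Q-periodic {u} = subst (Adj G x) (sym (period u))

  Q-periodic⁻ : ∀ {u} → Q (u + k) → Q u
  Q-periodic⁻ {u} = subst (Adj G x) (period u)

  ¬Qk : ¬ Q k
  ¬Qk = x≁s ∘ Q-periodic⁻ {0}

  P-injective : ∀ {u v} → u < v + k → v < u + k → P u ≡ P v → u ≡ v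
  P-injective u<v+k v<u+k e = c-injective s u<v+k v<u+k (cong (node C) e)

  P∈NC⁺ : ∀ {u} → Q u → P u ∈ NC G C x
  P∈NC⁺ = ∈-tabulate⁺ _

  P∈NC⁻ : ∀ {u} → P u ∈ NC G C x → Q u
  P∈NC⁻ = ∈-tabulate⁻ _

  Seg : ℕ → ℕ → Subset k
  Seg a zero = ⊥
  Seg a (suc r) = ⁅ P a ⁆ ∪ Seg (suc a) r

  seg⁻ : ∀ a r {i} → i ∈ Seg a r → ∃[ j ] a ≤ j × j < r + a × i ≡ P j
  seg⁻ a zero i∈ = contradiction i∈ ∉⊥
  seg⁻ a (suc r) i∈ with x∈p∪q⁻ ⁅ P a ⁆ (Seg (suc a) r) i∈
  ... | inj₁ i∈a = a , ≤-refl , s≤s (m≤n+m a r) , x∈⁅y⁆⇒x≡y (P a) i∈a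
  ... | inj₂ i∈rest with seg⁻ (suc a) r i∈rest
  ...   | j , sa≤j , j<r+sa , e = j , <⇒≤ sa≤j , subst (j <_) (+-suc r a) j<r+sa , e

  seg⁺ : ∀ a r {j} → a ≤ j → j < r + a → P j ∈ Seg a r
  seg⁺ a zero a≤j j<a = contradiction j<a (≤⇒≯ a≤j)
  seg⁺ a (suc r) {j} a≤j j<sr+a with m≤n⇒m<n∨m≡n a≤j
  ... | inj₂ refl = x∈p∪q⁺ (inj₁ (x∈⁅x⁆ (P a)))
  ... | inj₁ a<j = x∈p∪q⁺ (inj₂ (seg⁺ (suc a) r a<j (subst (j <_) (sym (+-suc r a)) j<sr+a)))

  seg-index : ∀ {a r u} → r + a ≤ k → u < k → P u ∈ Seg a r → a ≤ u × u < r + a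
  seg-index {a} {r} {u} r+a≤k u<k u∈ with seg⁻ a r u∈
  ... | j , a≤j , j<r+a , e
    with P-injective (<-≤-trans u<k (m≤n+m k j)) (<-≤-trans (<-≤-trans j<r+a r+a≤k) (m≤n+m k u)) e
  ...   | refl = a≤j , j<r+a

  seg-size : ∀ a r → r ≤ k → ∣ Seg a r ∣ ≡ r
  seg-size a zero _ = ∣⊥∣≡0 k
  seg-size a (suc r) r<k = trans (∣⁅i⁆∪p∣ (P a) (Seg (suc a) r) Pa∉) (cong suc (seg-size (suc a) r (<⇒≤ r<k)))
    where
    Pa∉ : P a ∉ Seg (suc a) r
    Pa∉ Pa∈ with seg⁻ (suc a) r Pa∈
    ... | j , sa≤j , j<r+sa , e = <⇒≢ sa≤j (P-injective (<-≤-trans sa≤j (m≤m+n j k))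
            (<-≤-trans (subst (j <_) (+-suc r a) j<r+sa) (≤-trans (+-monoˡ-≤ a r<k) (≤-reflexive (+-comm k a)))) e)

  seg-connected : ∀ a r → Connected (CAdj G C) (Seg a r)
  seg-connected a zero u v u∈ _ = contradiction u∈ ∉⊥
  seg-connected a (suc r) = connected-via-hub (adj-sym G) (P a) (to-start a r)
    where
    start∈ : ∀ a r → P a ∈ Seg a (suc r)
    start∈ a r = x∈p∪q⁺ (inj₁ (x∈⁅x⁆ (P a)))
    to-start : ∀ a r {i} → i ∈ Seg a (suc r) → Walk (CAdj G C) (Seg a (suc r)) i (P a)
    to-start a r i∈ with x∈p∪q⁻ ⁅ P a ⁆ (Seg (suc a) r) i∈
    ... | inj₁ i∈a =
      subst (λ i → Walk (CAdj G C) (Seg a (suc r)) i (P a)) (sym (x∈⁅y⁆⇒x≡y (P a) i∈a)) (here (start∈ a r))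
    to-start a zero i∈ | inj₂ i∈⊥ = contradiction i∈⊥ ∉⊥
    to-start a (suc r) i∈ | inj₂ i∈rest =
      walk-mono (q⊆p∪q ⁅ P a ⁆ (Seg (suc a) (suc r))) (to-start (suc a) r i∈rest)
      ++ʷ step (x∈p∪q⁺ (inj₂ (start∈ (suc a) r))) (adj-sym G (c-adjacent-succ s a)) (here (start∈ a (suc r)))

  NC-is : ∀ (X : Subset k) → (∀ {u} → u < k → P u ∈ X → Q u) → (∀ {u} → u < k → Q u → P u ∈ X) →
          X ≡ NC G C x
  NC-is X sound complete = ⊆-antisym to from
    where
    to : ∀ {i} → i ∈ X → i ∈ NC G C x
    to {i} i∈ with pos-cover s i
    ... | u , u<k , refl = P∈NC⁺ (sound u<k i∈)
    from : ∀ {i} → i ∈ NC G C x → i ∈ X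
    from {i} i∈ with pos-cover s i
    ... | u , u<k , refl = complete u<k (P∈NC⁻ i∈)

  record Run (a r : ℕ) : Set where
    field
      nonempty : 1 ≤ r
      fits     : r + a ≤ k
      seen     : ∀ {j} → a ≤ j → j < r + a → Q j
      ends     : ¬ Q (r + a)

  -- Every seen index below k starts a run (it ends by k since x does not see index k).
  run-from : ∀ {a} → a < k → Q a → ∃[ r ] Run a r
  run-from {a} a<k Qa with least-witness (λ j → ¬? (Q? j)) a (suc k)
  ... | inj₁ all-seen = contradiction (decidable-stable (Q? k) (all-seen (<⇒≤ a<k) (n<1+n k))) ¬Qk
  ... | inj₂ (e , a≤e , e<1+k , ¬Qe , seen-before) = e ∸ a , record
    { nonempty = m<n⇒0<n∸m a<e
    ; fits     = ≤-trans (≤-reflexive r+a≡e) (s≤s⁻¹ e<1+k)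
    ; seen     = λ a≤j j<r+a → decidable-stable (Q? _) (seen-before a≤j (subst (_ <_) r+a≡e j<r+a))
    ; ends     = subst (λ z → ¬ Q z) (sym r+a≡e) ¬Qe
    }
    where
    r+a≡e : e ∸ a + a ≡ e
    r+a≡e = m∸n+n≡m a≤e
    a<e : a < e
    a<e = ≤∧≢⇒< a≤e (λ { refl → ¬Qe Qa })

  -- A run has at most three nodes: four consecutive neighbours would give a beetle.
  run-short : BeetleFree G → ∀ {a r} → Run a r → r ≤ 3
  run-short beetle-free {a} {r} run with r ≤? 3
  ... | yes r≤3 = r≤3
  ... | no r≰3 = contradiction (FourConsecutive.beetle G C x x∉C (s + a)
                   (seen-at 0 z≤n) (seen-at 1 (s≤s z≤n)) (seen-at 2 (s≤s (s≤s z≤n)))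
                   (seen-at 3 (s≤s (s≤s (s≤s z≤n)))))
                   beetle-free
    where
    seen-at : ∀ i → i ≤ 3 → Adj G x (c (s + a + i))
    seen-at i i≤3 = subst (Adj G x ∘ c) (trans (cong (s +_) (+-comm i a)) (sym (+-assoc s a i)))
                      (Run.seen run (m≤n+m a i) (+-monoˡ-< a (≤-<-trans i≤3 (≰⇒> r≰3))))

  P-distinct : ∀ {u v} → u < v → v < u + k → P u ≢ P v
  P-distinct {u} {v} u<v v<u+k e = <⇒≢ u<v (P-injective (<-≤-trans u<v (m≤m+n v k)) v<u+k e)

  major-three : ∀ {u v w} → 1 ≤ u → suc u < v → suc v < w → w < k → Q u → Q v → Q w → Empty
  major-three {u} {v} {w} 1≤u su<v sv<w w<k Qu Qv Qw = x-minor (proj₁ x∈N , P u , P v , P w ,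
      P∈NC⁺ Qu , P∈NC⁺ Qv , P∈NC⁺ Qw ,
      P-distinct u<v (<-trans v<w w<u+k) , P-distinct (<-trans u<v v<w) w<u+k , P-distinct v<w w<v+k ,
      c-nonadjacent s su<v (<-trans sv<w w<u+k) , c-nonadjacent s (<-trans su<v v<w) sw<u+k ,
      c-nonadjacent s sv<w (<-≤-trans sw<u+k (+-monoˡ-≤ k (<⇒≤ u<v))))
    where
    u<v = <-trans (n<1+n u) su<v
    v<w = <-trans (n<1+n v) sv<w
    sw<u+k : suc w < u + k
    sw<u+k = ≤-<-trans w<k (m<n+m k 1≤u)
    w<u+k = <-trans (n<1+n w) sw<u+k
    w<v+k = <-≤-trans w<k (m≤n+m k v)

  NI-of : ∀ {a r} → Run a r → Seg a r ≡ NC G C x → NI G C r x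
  NI-of {a} {r} run eq = x∈N , x-minor ,
    trans (cong ∣_∣ (sym eq)) (seg-size a r (≤-trans (m≤m+n r a) (Run.fits run))) ,
    subst (Connected (CAdj G C)) eq (seg-connected a r)

  apart : ∀ {a r b r′ u v} → Run b r′ → 1 ≤ a → r + a < b → a ≤ u → u < r + a → b ≤ v → v < r′ + b →
          suc u < v × suc v < u + k
  apart run₂ 1≤a r+a<b a≤u u<r+a b≤v v<r′+b =
    <-≤-trans (≤-<-trans u<r+a r+a<b) b≤v ,
    ≤-<-trans (<-≤-trans v<r′+b (Run.fits run₂)) (m<n+m k (≤-trans 1≤a a≤u))

  NIJ-of : ∀ {a r b r′} → Run a r → Run b r′ → 1 ≤ a → r + a < b → Seg a r ∪ Seg b r′ ≡ NC G C x →
           NIJ G C r r′ x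
  NIJ-of {a} {r} {b} {r′} run₁ run₂ 1≤a r+a<b eq = x∈N , x-minor , Seg a r , Seg b r′ , eq ,
    Empty-unique disjoint ,
    (P a , seg⁺ a r ≤-refl (m<n+m a (Run.nonempty run₁))) ,
    (P b , seg⁺ b r′ ≤-refl (m<n+m b (Run.nonempty run₂))) ,
    seg-connected a r , seg-connected b r′ , non-adjacent ,
    seg-size a r (≤-trans (m≤m+n r a) (<⇒≤ (<-trans r+a<b b<k))) ,
    seg-size b r′ (≤-trans (m≤m+n r′ b) (Run.fits run₂))
    where
    b<k : b < k
    b<k = <-≤-trans (m<n+m b (Run.nonempty run₂)) (Run.fits run₂)
    disjoint : ¬ (∃[ i ] i ∈ Seg a r ∩ Seg b r′)
    disjoint (i , i∈) with x∈p∩q⁻ (Seg a r) (Seg b r′) i∈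
    ... | i∈A , i∈B with seg⁻ a r i∈A | seg⁻ b r′ i∈B
    ...   | u , a≤u , u<r+a , refl | v , b≤v , v<r′+b , e with apart run₂ 1≤a r+a<b a≤u u<r+a b≤v v<r′+b
    ...     | su<v , sv<u+k = P-distinct (<-trans (n<1+n u) su<v) (<-trans (n<1+n v) sv<u+k) e
    non-adjacent : ∀ i j → i ∈ Seg a r → j ∈ Seg b r′ → ¬ CAdj G C i j
    non-adjacent i j i∈A j∈B with seg⁻ a r i∈A | seg⁻ b r′ j∈B
    ... | u , a≤u , u<r+a , refl | v , b≤v , v<r′+b , refl with apart run₂ 1≤a r+a<b a≤u u<r+a b≤v v<r′+b
    ...   | su<v , sv<u+k = c-nonadjacent s su<v sv<u+k

  NC-one-run : ∀ {a r} → Run a r → NoneOn Q 0 a → NoneOn Q (r + a) k → Seg a r ≡ NC G C x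
  NC-one-run {a} {r} run before after = NC-is (Seg a r) sound complete
    where
    sound : ∀ {u} → u < k → P u ∈ Seg a r → Q u
    sound u<k u∈ with seg-index (Run.fits run) u<k u∈
    ... | a≤u , u<r+a = Run.seen run a≤u u<r+a
    complete : ∀ {u} → u < k → Q u → P u ∈ Seg a r
    complete {u} u<k Qu with a ≤? u | u <? r + a
    ... | no a≰u | _ = contradiction Qu (before z≤n (≰⇒> a≰u))
    ... | yes a≤u | yes u<r+a = seg⁺ a r a≤u u<r+a
    ... | yes _ | no u≮r+a = contradiction Qu (after (≮⇒≥ u≮r+a) u<k)

  NC-two-runs : ∀ {a r b r′} → Run a r → Run b r′ → NoneOn Q 0 a → NoneOn Q (r + a) b → NoneOn Q (r′ + b) k →
                Seg a r ∪ Seg b r′ ≡ NC G C x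
  NC-two-runs {a} {r} {b} {r′} run₁ run₂ before gap after = NC-is (Seg a r ∪ Seg b r′) sound complete
    where
    sound : ∀ {u} → u < k → P u ∈ Seg a r ∪ Seg b r′ → Q u
    sound u<k u∈ with x∈p∪q⁻ (Seg a r) (Seg b r′) u∈
    ... | inj₁ u∈A = let (a≤u , u<r+a) = seg-index (Run.fits run₁) u<k u∈A in Run.seen run₁ a≤u u<r+a
    ... | inj₂ u∈B = let (b≤u , u<r′+b) = seg-index (Run.fits run₂) u<k u∈B in Run.seen run₂ b≤u u<r′+b
    complete : ∀ {u} → u < k → Q u → P u ∈ Seg a r ∪ Seg b r′
    complete {u} u<k Qu with a ≤? u | u <? r + a | b ≤? u | u <? r′ + b
    ... | no a≰u | _ | _ | _ = contradiction Qu (before z≤n (≰⇒> a≰u))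
    ... | yes a≤u | yes u<r+a | _ | _ = x∈p∪q⁺ (inj₁ (seg⁺ a r a≤u u<r+a))
    ... | yes _ | no u≮r+a | no b≰u | _ = contradiction Qu (gap (≮⇒≥ u≮r+a) (≰⇒> b≰u))
    ... | yes _ | no _ | yes b≤u | yes u<r′+b = x∈p∪q⁺ (inj₂ (seg⁺ b r′ b≤u u<r′+b))
    ... | yes _ | no _ | yes _ | no u≮r′+b = contradiction Qu (after (≮⇒≥ u≮r′+b) u<k)

  wrap-around : ∀ {a e} → NoneOn Q 0 a → NoneOn Q e k → NoneOn Q e (a + k)
  wrap-around {a} before after {j} e≤j j<a+k Qj with j <? k
  ... | yes j<k = after e≤j j<k Qj
  ... | no j≮k = before z≤n (+-cancelʳ-< k (j ∸ k) a (subst (_< a + k) (sym j∸k+k≡j) j<a+k))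
                   (Q-periodic⁻ (subst Q (sym j∸k+k≡j) Qj))
    where
    j∸k+k≡j : j ∸ k + k ≡ j
    j∸k+k≡j = m∸n+n≡m (≮⇒≥ j≮k)

  hole-from-gap : ∀ u m → 2 ≤ m → suc m < k → Q u → Q (u + m) → NoneOn Q (suc u) (u + m) →
                  Σ (Hole G) (λ H → len H ≡ suc (suc m))
  hole-from-gap u m 2≤m m+1<k Qu Qu+m unseen =
    GapHole.gap-hole G C x x∉C (s + u) m 2≤m m+1<k
      (from-Q 0 (subst Q (sym (+-identityʳ u)) Qu)) (from-Q m Qu+m) interior , refl
    where
    from-Q : ∀ j → Q (u + j) → Adj G x (c (s + u + j))
    from-Q j = subst (Adj G x ∘ c) (sym (+-assoc s u j))
    interior : ∀ j → 0 < j → j < m → ¬ Adj G x (c (s + u + j))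
    interior j 0<j j<m h = unseen (m<m+n u 0<j) (+-monoʳ-< u j<m) (subst (Adj G x ∘ c) (+-assoc s u j) h)

  odd-split : ShortestEvenHole G C → ∀ {u v w a} → Q u → Q v → Q w → Q a → suc u < v → suc w < a + k →
              NoneOn Q (suc u) v → NoneOn Q (suc w) (a + k) → suc (v + a) ≡ u + w → Empty
  odd-split seh {u} {v} {w} {a} Qu Qv Qw Qa su<v sw<a+k gap₁ gap₂ balance =
    no-complementary-holes G C seh 2≤m₁ 2≤m₂ split (proj₁ H₁) (proj₁ H₂) (proj₂ H₁) (proj₂ H₂)
    where
    m₁ = v ∸ u
    m₂ = a + k ∸ w
    u+m₁ : u + m₁ ≡ v
    u+m₁ = m+[n∸m]≡n (<⇒≤ (<-trans (n<1+n u) su<v))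
    w+m₂ : w + m₂ ≡ a + k
    w+m₂ = m+[n∸m]≡n (<⇒≤ (<-trans (n<1+n w) sw<a+k))
    2≤m₁ : 2 ≤ m₁
    2≤m₁ = +-cancelˡ-≤ u 2 m₁ (subst₂ _≤_ (+-comm 2 u) (sym u+m₁) su<v)
    2≤m₂ : 2 ≤ m₂
    2≤m₂ = +-cancelˡ-≤ w 2 m₂ (subst₂ _≤_ (+-comm 2 w) (sym w+m₂) sw<a+k)
    split : suc m₁ + m₂ ≡ k
    split = +-cancelˡ-≡ (u + w) (suc m₁ + m₂) k (begin
      u + w + (suc m₁ + m₂)       ≡⟨ regroup u w m₁ m₂ ⟩
      suc ((u + m₁) + (w + m₂))   ≡⟨ cong₂ (λ p q → suc (p + q)) u+m₁ w+m₂ ⟩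
      suc (v + (a + k))           ≡⟨ cong suc (sym (+-assoc v a k)) ⟩
      suc (v + a) + k             ≡⟨ cong (_+ k) balance ⟩
      u + w + k                   ∎)
      where open ≡-Reasoning
    H₁ = hole-from-gap u m₁ 2≤m₁ (subst (suc m₁ <_) split (m<m+n (suc m₁) (<-trans (s≤s z≤n) 2≤m₂)))
           Qu (subst Q (sym u+m₁) Qv) (subst (NoneOn Q (suc u)) (sym u+m₁) gap₁)
    H₂ = hole-from-gap w m₂ 2≤m₂ (subst (suc m₂ <_) split (s≤s (m<n+m m₂ (<-trans (s≤s z≤n) 2≤m₁))))
           Qw (subst Q (sym w+m₂) (Q-periodic Qa)) (subst (NoneOn Q (suc w)) (sym w+m₂) gap₂)

  one-run : BeetleFree G → ∀ {a r} → Run a r → NoneOn Q 0 a → NoneOn Q (r + a) k → Outcome G C x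
  one-run beetle-free {r = r} run before after =
    by-length r (Run.nonempty run) (run-short beetle-free run) (NI-of run (NC-one-run run before after))
    where
    by-length : ∀ r → 1 ≤ r → r ≤ 3 → NI G C r x → Outcome G C x
    by-length 1 _ _ ni = inj₂ (inj₁ ni)
    by-length 2 _ _ ni = inj₂ (inj₂ (inj₁ ni))
    by-length 3 _ _ ni = inj₂ (inj₂ (inj₂ ni))
    by-length (suc (suc (suc (suc _)))) _ (s≤s (s≤s (s≤s ()))) _

  past-run : ∀ {a r b} → Run a r → r + a ≤ b → Q b → r + a < b
  past-run run r+a≤b Qb = ≤∧≢⇒< r+a≤b (λ { refl → Run.ends run Qb })

  beyond-start : ∀ {a r b} → Run a r → r + a < b → suc a < b
  beyond-start {a} run r+a<b = ≤-<-trans (+-monoˡ-≤ a (Run.nonempty run)) r+a<b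

  long-run-major : ∀ {a r b r′} → Run a r → Run b r′ → 1 ≤ a → r + a < b → 3 ≤ r ⊎ 3 ≤ r′ → Empty
  long-run-major {a} {r} {b} {r′} run₁ run₂ 1≤a r+a<b (inj₁ 3≤r) =
    major-three 1≤a ≤-refl (≤-<-trans (+-monoˡ-≤ a 3≤r) r+a<b)
      (<-≤-trans (m<n+m b (Run.nonempty run₂)) (Run.fits run₂))
      (Run.seen run₁ ≤-refl (m<n+m a (Run.nonempty run₁))) (Run.seen run₁ (m≤n+m a 2) (+-monoˡ-< a 3≤r))
      (Run.seen run₂ ≤-refl (m<n+m b (Run.nonempty run₂)))
  long-run-major {a} {r} {b} {r′} run₁ run₂ 1≤a r+a<b (inj₂ 3≤r′) =
    major-three 1≤a (beyond-start run₁ r+a<b) ≤-refl (<-≤-trans (+-monoˡ-≤ b 3≤r′) (Run.fits run₂))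
      (Run.seen run₁ ≤-refl (m<n+m a (Run.nonempty run₁))) (Run.seen run₂ ≤-refl (m<n+m b (Run.nonempty run₂)))
      (Run.seen run₂ (m≤n+m b 2) (+-monoˡ-< b 3≤r′))

  -- Two separated runs, with nothing else seen, yield N^{1,1}: a run of length three makes x
  -- major, two runs of length two make it an N^{2,2} node, and runs of lengths one and two
  -- close an even hole shorter than C.
  two-runs : ¬ NIJ G C 2 2 x → ShortestEvenHole G C → ∀ {a r b r′} → Run a r → Run b r′ → 1 ≤ a → r + a < b →
             NoneOn Q 0 a → NoneOn Q (r + a) b → NoneOn Q (r′ + b) k → Outcome G C x
  two-runs not-22 seh {a} {r} {b} {r′} run₁ run₂ 1≤a r+a<b before gap after with 3 ≤? r | 3 ≤? r′
  ... | yes 3≤r | _ = ⊥-elim (long-run-major run₁ run₂ 1≤a r+a<b (inj₁ 3≤r))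
  ... | no _ | yes 3≤r′ = ⊥-elim (long-run-major run₁ run₂ 1≤a r+a<b (inj₂ 3≤r′))
  ... | no r≱3 | no r′≱3 = by-lengths r r′ run₁ run₂ r+a<b gap after (Run.nonempty run₁) (Run.nonempty run₂)
                             (s≤s⁻¹ (≰⇒> r≱3)) (s≤s⁻¹ (≰⇒> r′≱3))
    where
    by-lengths : ∀ r r′ → Run a r → Run b r′ → r + a < b → NoneOn Q (r + a) b → NoneOn Q (r′ + b) k →
                 1 ≤ r → 1 ≤ r′ → r ≤ 2 → r′ ≤ 2 → Outcome G C x
    by-lengths 1 1 run₁ run₂ r+a<b gap after _ _ _ _ =
      inj₁ (NIJ-of run₁ run₂ 1≤a r+a<b (NC-two-runs run₁ run₂ before gap after))
    by-lengths 2 2 run₁ run₂ r+a<b gap after _ _ _ _ =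
      ⊥-elim (not-22 (NIJ-of run₁ run₂ 1≤a r+a<b (NC-two-runs run₁ run₂ before gap after)))
    by-lengths 1 2 run₁ run₂ r+a<b gap after _ _ _ _ =
      ⊥-elim (odd-split seh (Run.seen run₁ ≤-refl ≤-refl) (Run.seen run₂ ≤-refl (s≤s (n≤1+n b)))
                (Run.seen run₂ (n≤1+n b) ≤-refl) (Run.seen run₁ ≤-refl ≤-refl) r+a<b
                (≤-<-trans (Run.fits run₂) (m<n+m k 1≤a)) gap (wrap-around before after)
                (trans (cong suc (+-comm b a)) (sym (+-suc a b))))
    by-lengths 2 1 run₁ run₂ r+a<b gap after _ _ _ _ =
      ⊥-elim (odd-split seh (Run.seen run₁ (n≤1+n a) ≤-refl) (Run.seen run₂ ≤-refl ≤-refl)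
                (Run.seen run₂ ≤-refl ≤-refl) (Run.seen run₁ ≤-refl (s≤s (n≤1+n a))) r+a<b
                (≤-<-trans (Run.fits run₂) (m<n+m k 1≤a)) gap (wrap-around before after)
                (cong suc (+-comm b a)))
    by-lengths (suc (suc (suc _))) _ _ _ _ _ _ _ _ (s≤s (s≤s ())) _
    by-lengths _ (suc (suc (suc _))) _ _ _ _ _ _ _ _ (s≤s (s≤s ()))

  first-positive : ∀ {a} → Q a → 1 ≤ a
  first-positive Qa = n≢0⇒n>0 (λ { refl → x≁s Qa })

  -- The classification, given that x sees some index below k: the first seen index starts
  -- a run, which is followed by at most one further run.
  classify : BeetleFree G → ¬ NIJ G C 2 2 x → ShortestEvenHole G C → ∃[ u ] u < k × Q u → Outcome G C x
  classify beetle-free not-22 seh (u , u<k , Qu) with least-witness Q? 0 k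
  ... | inj₁ unseen = contradiction Qu (unseen z≤n u<k)
  ... | inj₂ (a , _ , a<k , Qa , before) with run-from a<k Qa
  ...   | r , run₁ with least-witness Q? (r + a) k
  ...     | inj₁ after = one-run beetle-free run₁ before after
  ...     | inj₂ (b , r+a≤b , b<k , Qb , gap) with run-from b<k Qb | past-run run₁ r+a≤b Qb
  ...       | r′ , run₂ | r+a<b with least-witness Q? (r′ + b) k
  ...         | inj₁ after = two-runs not-22 seh run₁ run₂ (first-positive Qa) r+a<b before gap after
  ...         | inj₂ (w , r′+b≤w , w<k , Qw , _) = ⊥-elim (major-three (first-positive Qa) (beyond-start run₁ r+a<b)
                  (beyond-start run₂ (past-run run₂ r′+b≤w Qw)) w<k Qa Qb Qw)

lemma2 : (G : Graph) → BeetleFree G → (C : Hole G) → Clean G C →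
         ShortestEvenHole G C → ∀ x → InN G C x →
         NIJ G C 1 1 x ⊎ NI G C 1 x ⊎ NI G C 2 x ⊎ NI G C 3 x
lemma2 G beetle-free C (no-major , no-22) seh x x∈N with Attachment.unseen-index G C x x∈N beetle-free
... | s , x≁s = Around.classify G C x x∈N (no-major x) s x≁s beetle-free (no-22 x) seh
                  (Attachment.seen-below-k G C x x∈N s)
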